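{- Let $n\ge 1$ and $t\ge 2n$ be integers and let $C_t$ be the cycle with vertex set $[t]$ and edges $\{1,2\},\{2,3\},\dots,\{t-1,t\},\{t,1\}$ (indices of vertices taken modulo $t$). Then: (A) $f_{C_t}(n,n-1)=n-1$. (B) Let $\mathcal{F}$ be a collection of $n$ (not necessarily distinct) independent $n$-sets of $C_t$, and let $m$ be the maximum size of a rainbow independent set of $(\mathcal{F},C_t)$. Then $m\ge n-1$. Moreover, if $m=n-1$, then: (B1) $c_{\mathcal{F}}(i)>0$ for every $i\in[t]$; (B2) if $C_{\mathcal{F}}(i)=\{I\}$ for some $i\in[t]$, then $I\in C_{\mathcal{F}}(i+2)$ and $I\in C_{\mathcal{F}}(i-2)$; (B3) if $t\ge 2n+1$ and $c_{\mathcal{F}}(i)=1$ for some $i\in[t]$, then $c_{\mathcal{F}}(i+1)>1$ and $c_{\mathcal{F}}(i-1)>1$.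
   Context: For a collection $\mathcal{F}=(F_1,\dots,F_k)$ of sets, a rainbow set is a set $\{x_{i_1},\dots,x_{i_m}\}$ of $m$ distinct elements with distinct indices $i_1<\dots<i_m$ in $[k]$ and $x_{i_j}\in F_{i_j}$; a rainbow independent set of $(\mathcal{F},G)$ is a rainbow set that is independent in $G$. For $m\le n$, $f_G(n,m)$ is the minimal number $k$ such that every collection of $k$ independent $n$-sets of $G$ has a rainbow independent $m$-set. For a vertex $v$, $C_{\mathcal{F}}(v)$ is the list of members of $\mathcal{F}$ (with multiplicity, by index) containing $v$, and $c_{\mathcal{F}}(v)=|C_{\mathcal{F}}(v)|$. -}

module Defs where

open import Data.Nat using (ℕ; zero; suc; _+_; _∸_; _<_)
open import Data.Nat.DivMod using (_%_; m%n<n)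
open import Data.Fin using (Fin; toℕ; fromℕ<) renaming (_<_ to _<ᶠ_)
open import Data.Fin.Subset using (Subset; _∈_)
open import Data.Fin.Subset.Properties using (_∈?_)
open import Data.List using (List; filter; length; allFin)
open import Data.Product using (Σ; _×_)
open import Data.Sum using (_⊎_)
open import Function.Definitions using (Injective)
open import Relation.Binary.PropositionalEquality using (_≡_)
open import Relation.Nullary using (¬_)

Graph : ℕ → Set₁
Graph t = Fin t → Fin t → Set

-- shift k i = i + k (mod t)   (vertex i of Fin t stands for vertex i+1 of [t])
shift : ∀ {t} → ℕ → Fin t → Fin t
shift {suc t} k i = fromℕ< (m%n<n (toℕ i + k) (suc t))

next next2 prev prev2 : ∀ {t} → Fin t → Fin t
next i = shift 1 i
next2 i = shift 2 i
prev {t} i = shift (t ∸ 1) i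
prev2 {t} i = shift (t ∸ 2) i

Cycle : (t : ℕ) → Graph t
Cycle t u v = (v ≡ next u) ⊎ (u ≡ next v)

Independent : ∀ {t} → Graph t → Subset t → Set
Independent G S = ∀ u v → u ∈ S → v ∈ S → ¬ G u v

Collection : ℕ → ℕ → Set
Collection k t = Fin k → Subset t

IndepNSets : ∀ {k t} → Graph t → ℕ → Collection k t → Set
IndepNSets G n F = ∀ i → Independent G (F i) × Data.Fin.Subset.∣ F i ∣ ≡ n

record RainbowIndep {k t} (G : Graph t) (F : Collection k t) (m : ℕ) : Set where
  field
    idx     : Fin m → Fin k
    idx-inc : ∀ a b → a <ᶠ b → idx a <ᶠ idx b
    elt     : Fin m → Fin t
    elt-inj : Injective _≡_ _≡_ elt
    elt-mem : ∀ a → elt a ∈ F (idx a)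
    indep   : ∀ a b → ¬ G (elt a) (elt b)

RainbowProperty : ∀ {t} → Graph t → ℕ → ℕ → ℕ → Set
RainbowProperty {t} G n m k =
  (F : Collection k t) → IndepNSets G n F → RainbowIndep G F m

IsF : ∀ {t} → Graph t → ℕ → ℕ → ℕ → Set
IsF G n m k = RainbowProperty G n m k × (∀ k′ → k′ < k → ¬ RainbowProperty G n m k′)

IsMaxRainbow : ∀ {k t} → Graph t → Collection k t → ℕ → Set
IsMaxRainbow G F m = RainbowIndep G F m × (∀ m′ → RainbowIndep G F m′ → m′ Data.Nat.≤ m)

C : ∀ {k t} → Collection k t → Fin t → List (Fin k)
C F v = filter (λ i → v ∈? F i) (allFin _)

c : ∀ {k t} → Collection k t → Fin t → ℕ
c F v = length (C F v)

-- Unroll C_t along ℕ, position j standing for vertex j mod t.  Inside a window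
-- of t − 1 consecutive positions, positions at distance at least 2 are distinct,
-- non-adjacent vertices, and an independent set never occupies two consecutive
-- positions.  Hence a greedy scan builds rainbow independent sets: going left to
-- right, whenever some still unserved set occupies the current position, serve it
-- there and skip the next position; every other set loses at most one of its
-- positions.  So if each of m sets has at least m positions in the window, all m
-- of them are served.
--
-- An independent n-set loses at most one vertex to a window of length t − 1,
-- which gives rainbow (n − 1)-sets: this is (A) and m ≥ n − 1.  If m = n − 1,
-- each configuration excluded by (B1)–(B3) yields a rainbow n-set: an uncovered
-- vertex leaves all n positions of every set in the window starting after it; in
-- (B2) and (B3) one, resp. two, sets are served at the start of a window in which
-- every other set loses at most one, resp. two, positions.  Minimality in (A)
-- holds because fewer than n − 1 sets cannot carry n − 1 increasing indices, and
-- the vertices 0, 2, …, 2n − 2 form an independent n-set as t ≥ 2n.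

module Submission where

open import Defs
open import Data.Nat using (ℕ; _≤_; _<_; _*_; _∸_; suc)
open import Data.Fin using (Fin)
open import Data.List using ([_])
open import Data.List.Membership.Propositional using (_∈_)
open import Data.Product using (_×_)
open import Relation.Binary.PropositionalEquality using (_≡_)

open import Data.Bool.Base using (Bool; true; false; T; if_then_else_)
open import Data.Empty using (⊥; ⊥-elim)
open import Data.Fin.Base using (zero; suc; toℕ) renaming (_<_ to _<ᶠ_)
open import Data.Fin.Properties using (_≟_; any?)
import Data.Fin.Properties as Finₚ
open import Data.Fin.Subset using (Subset; inside; outside; ⊤; ∣_∣; _-_; ⁅_⁆; Nonempty)
  renaming (_∈_ to _∈ₛ_; _∉_ to _∉ₛ_)
open import Data.Fin.Subset.Properties using (_∈?_; ∣⊤∣≡n; ∈⊤; p─⊥≡p; p─q⊆p; x∈p∧x≢y⇒x∈p-y)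
open import Data.List.Base using ([]; _∷_; length; allFin)
open import Data.List.Membership.Propositional.Properties using (∈-filter⁺; ∈-filter⁻; ∈-allFin; ∈-length)
open import Data.List.Relation.Unary.Any using (here)
open import Data.Maybe.Base using (Maybe; just; nothing)
open import Data.Maybe.Properties using (just-injective)
open import Data.Nat.Base using (zero; _+_; pred; z≤n; s≤s; z<s)
open import Data.Nat.DivMod
open import Data.Nat.Properties hiding (_≟_)
open import Data.Product.Base using (∃; _,_; proj₁; proj₂)
open import Data.Sum.Base using (_⊎_; inj₁; inj₂; reduce)
open import Data.Unit.Base using (tt)
open import Data.Vec.Base using (_∷_; []; lookup; tabulate; here; there)
open import Data.Vec.Functional using (updateAt)
open import Data.Vec.Functional.Properties using (updateAt-updates; updateAt-minimal)
open import Data.Vec.Properties using (lookup∘tabulate; []=⇒lookup)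
open import Function.Base using (_∘_; const)
open import Relation.Binary.Definitions using (tri<; tri≈; tri>)
open import Relation.Binary.PropositionalEquality hiding ([_]; J)
open import Relation.Nullary.Decidable.Core using (does; yes; no; T?; _×-dec_)
open import Relation.Nullary.Negation using (¬_; contradiction)

-- Counting positions along ℕ

count : (ℕ → Bool) → ℕ → ℕ → ℕ
count f a zero    = 0
count f a (suc L) = if f a then suc (count f (suc a) L) else count f (suc a) L

Sparse : (ℕ → Bool) → Set
Sparse f = ∀ j → T (f j) → ¬ T (f (suc j))

module _ (f : ℕ → Bool) where

  count-++ : ∀ a d L → count f a (d + L) ≡ count f a d + count f (d + a) L
  count-++ a zero    L = refl
  count-++ a (suc d) L rewrite count-++ (suc a) d L | +-suc d a with f a
  ... | true  = refl
  ... | false = refl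

  count-split : ∀ a d L → count f a L ≤ count f a d + count f (d + a) (L ∸ d)
  count-split a d L with ≤-total d L
  ... | inj₁ d≤L = ≤-reflexive (trans (cong (count f a) (sym (m+[n∸m]≡n d≤L))) (count-++ a d (L ∸ d)))
  ... | inj₂ L≤d = begin
    count f a L                                ≤⟨ m≤m+n _ _ ⟩
    count f a L + count f (L + a) (d ∸ L)      ≡⟨ count-++ a L (d ∸ L) ⟨
    count f a (L + (d ∸ L))                    ≡⟨ cong (count f a) (m+[n∸m]≡n L≤d) ⟩
    count f a d                                ≤⟨ m≤m+n _ _ ⟩
    count f a d + count f (d + a) (L ∸ d)      ∎
    where open ≤-Reasoning

  count-skip : ∀ a L → ¬ T (f a) → count f a (suc L) ≡ count f (suc a) L
  count-skip a L ¬fa with f a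
  ... | true  = ⊥-elim (¬fa tt)
  ... | false = refl

  count-drop-first : ∀ a L → count f a (suc L) ≤ suc (count f (suc a) L)
  count-drop-first a L with f a
  ... | true  = ≤-refl
  ... | false = n≤1+n _

  count-≤ : ∀ a L → count f a L ≤ L
  count-≤ a zero = z≤n
  count-≤ a (suc L) with f a
  ... | true  = s≤s (count-≤ (suc a) L)
  ... | false = m≤n⇒m≤1+n (count-≤ (suc a) L)

  module _ (sparse : Sparse f) where

    count-pair : ∀ a → count f a 2 ≤ 1
    count-pair a with f a in fa | f (suc a) in fa′
    ... | true  | true  = ⊥-elim (sparse a (subst T (sym fa) tt) (subst T (sym fa′) tt))
    ... | true  | false = ≤-refl
    ... | false | true  = ≤-refl
    ... | false | false = z≤n

    count-after-pick : ∀ a L → count f a (suc L) ≤ suc (count f (2 + a) (pred L))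
    count-after-pick a zero    = count-≤ a 1
    count-after-pick a (suc L) = begin
      count f a (2 + L)                   ≡⟨ count-++ a 2 L ⟩
      count f a 2 + count f (2 + a) L     ≤⟨ +-monoˡ-≤ _ (count-pair a) ⟩
      suc (count f (2 + a) L)             ∎
      where open ≤-Reasoning

    count-three-absent-first : ∀ a → ¬ T (f a) → count f a 3 ≤ 1
    count-three-absent-first a ¬fa = ≤-trans (≤-reflexive (count-skip a 2 ¬fa)) (count-pair (suc a))

    count-three-absent-last : ∀ a → ¬ T (f (2 + a)) → count f a 3 ≤ 1
    count-three-absent-last a ¬f[2+a] = begin
      count f a 3                         ≡⟨ count-++ a 2 1 ⟩
      count f a 2 + count f (2 + a) 1     ≡⟨ cong (count f a 2 +_) (count-skip (2 + a) 0 ¬f[2+a]) ⟩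
      count f a 2 + 0                     ≤⟨ +-monoˡ-≤ 0 (count-pair a) ⟩
      1                                   ∎
      where open ≤-Reasoning

    count-six-absent-middle : ∀ a → ¬ T (f (2 + a)) → ¬ T (f (3 + a)) → count f a 6 ≤ 2
    count-six-absent-middle a ¬f[2+a] ¬f[3+a] = begin
      count f a 6                         ≡⟨ count-++ a 2 4 ⟩
      count f a 2 + count f (2 + a) 4     ≡⟨ cong (count f a 2 +_) middle ⟩
      count f a 2 + count f (4 + a) 2     ≤⟨ +-mono-≤ (count-pair a) (count-pair (4 + a)) ⟩
      2                                   ∎
      where
      open ≤-Reasoning
      middle : count f (2 + a) 4 ≡ count f (4 + a) 2
      middle = trans (count-skip (2 + a) 3 ¬f[2+a]) (count-skip (3 + a) 2 ¬f[3+a])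

  count-periodic : ∀ t → (∀ j → f (t + j) ≡ f j) → ∀ a → count f a t ≡ count f 0 t
  count-periodic t periodic zero    = refl
  count-periodic t periodic (suc a) = trans step (count-periodic t periodic a)
    where
    open ≡-Reasoning
    step : count f (suc a) t ≡ count f a t
    step = +-cancelˡ-≡ (count f a 1) _ _ (begin
      count f a 1 + count f (suc a) t     ≡⟨ count-++ a 1 t ⟨
      count f a (1 + t)                   ≡⟨ cong (count f a) (+-comm 1 t) ⟩
      count f a (t + 1)                   ≡⟨ count-++ a t 1 ⟩
      count f a t + count f (t + a) 1     ≡⟨ cong (λ b → count f a t + (if b then 1 else 0)) (periodic a) ⟩
      count f a t + count f a 1           ≡⟨ +-comm (count f a t) _ ⟩
      count f a 1 + count f a t           ∎)

count-suc : ∀ f a L → count f (suc a) L ≡ count (f ∘ suc) a L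
count-suc f a zero    = refl
count-suc f a (suc L) with f (suc a)
... | true  = cong suc (count-suc f (suc a) L)
... | false = count-suc f (suc a) L

count-subset : ∀ {m} (S : Subset m) (f : ℕ → Bool) →
               (∀ i → f (toℕ i) ≡ lookup S i) → count f 0 m ≡ ∣ S ∣
count-subset []                f agree = refl
count-subset {suc m} (inside ∷ S)  f agree rewrite agree zero =
  cong suc (trans (count-suc f 0 m) (count-subset S (f ∘ suc) (agree ∘ suc)))
count-subset {suc m} (outside ∷ S) f agree rewrite agree zero =
  trans (count-suc f 0 m) (count-subset S (f ∘ suc) (agree ∘ suc))

count-false : ∀ a L → count (λ _ → false) a L ≡ 0
count-false a zero    = refl
count-false a (suc L) = count-false (suc a) L

split-window : ∀ {a d L x} → d + a ≤ x → x < d + a + (L ∸ d) → x < a + L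
split-window {a} {d} {L} {x} d+a≤x x<end with ≤-total d L
... | inj₁ d≤L = ≤-trans x<end (≤-reflexive (begin
  d + a + (L ∸ d)     ≡⟨ cong (_+ (L ∸ d)) (+-comm d a) ⟩
  a + d + (L ∸ d)     ≡⟨ +-assoc a d (L ∸ d) ⟩
  a + (d + (L ∸ d))   ≡⟨ cong (a +_) (m+[n∸m]≡n d≤L) ⟩
  a + L               ∎))
  where open ≡-Reasoning
... | inj₂ L≤d = contradiction d+a≤x (<⇒≱ (subst (x <_) empty x<end))
  where
  empty : d + a + (L ∸ d) ≡ d + a
  empty = trans (cong (d + a +_) (m≤n⇒m∸n≡0 L≤d)) (+-identityʳ _)

-- Transversals and the greedy scan

x∉p-x : ∀ {k} (p : Subset k) x → x ∉ₛ p - x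
x∉p-x (b ∷ p) zero    ()
x∉p-x (b ∷ p) (suc x) (there x∈p-x) = x∉p-x p x x∈p-x

∣p∣≡1+∣p-x∣ : ∀ {k} {p : Subset k} {x} → x ∈ₛ p → ∣ p ∣ ≡ suc ∣ p - x ∣
∣p∣≡1+∣p-x∣ {p = inside ∷ p}  here          = cong (suc ∘ ∣_∣) (sym (p─⊥≡p p))
∣p∣≡1+∣p-x∣ {p = inside ∷ p}  (there x∈p)   = cong suc (∣p∣≡1+∣p-x∣ x∈p)
∣p∣≡1+∣p-x∣ {p = outside ∷ p} (there x∈p)   = ∣p∣≡1+∣p-x∣ x∈p

∣p∣>0⇒Nonempty : ∀ {k} (p : Subset k) → 0 < ∣ p ∣ → Nonempty p
∣p∣>0⇒Nonempty (inside ∷ p)  _ = zero , here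
∣p∣>0⇒Nonempty (outside ∷ p) h with ∣p∣>0⇒Nonempty p h
... | x , x∈p = suc x , there x∈p

#just : ∀ {k} {A : Set} → (Fin k → Maybe A) → ℕ
#just {zero}  f = 0
#just {suc k} f with f zero
... | just _  = suc (#just (f ∘ suc))
... | nothing = #just (f ∘ suc)

#just-updateAt : ∀ {k} {A : Set} (f : Fin k → Maybe A) J {x} → f J ≡ nothing →
                 #just (updateAt f J (const (just x))) ≡ suc (#just f)
#just-updateAt f zero    fJ≡nothing rewrite fJ≡nothing = refl
#just-updateAt f (suc J) fJ≡nothing with f zero
... | just _  = cong suc (#just-updateAt (f ∘ suc) J fJ≡nothing)
... | nothing = #just-updateAt (f ∘ suc) J fJ≡nothing

record Enumeration {k} {A : Set} (f : Fin k → Maybe A) (m : ℕ) : Set where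
  field
    index      : Fin m → Fin k
    increasing : ∀ a b → a <ᶠ b → index a <ᶠ index b
    value      : Fin m → A
    index-just : ∀ a → f (index a) ≡ just (value a)

enumerate : ∀ {k} {A : Set} (f : Fin k → Maybe A) → Enumeration f (#just f)
enumerate {zero}  f = record { index = λ () ; increasing = λ () ; value = λ () ; index-just = λ () }
enumerate {suc k} f with f zero in f0
... | nothing = record
  { index = suc ∘ index ; increasing = λ a b a<b → s≤s (increasing a b a<b)
  ; value = value ; index-just = index-just }
  where open Enumeration (enumerate (f ∘ suc))
... | just x = record
  { index = λ { zero → zero ; (suc a) → suc (index a) }
  ; increasing = λ { zero (suc b) _ → s≤s z≤n ; (suc a) (suc b) (s≤s a<b) → s≤s (increasing a b a<b) }
  ; value = λ { zero → x ; (suc a) → value a }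
  ; index-just = λ { zero → f0 ; (suc a) → index-just a } }
  where open Enumeration (enumerate (f ∘ suc))

updateAt-just : ∀ {k} {A : Set} (f : Fin k → Maybe A) J {y i x} →
                updateAt f J (const (just y)) i ≡ just x →
                (i ≡ J × x ≡ y) ⊎ (i ≢ J × f i ≡ just x)
updateAt-just f J {i = i} eq with i ≟ J
... | yes refl = inj₁ (refl , just-injective (trans (sym eq) (updateAt-updates J f)))
... | no  i≢J  = inj₂ (i≢J , trans (sym (updateAt-minimal i J f i≢J)) eq)

Apart : ℕ → ℕ → Set
Apart x y = 2 + x ≤ y ⊎ 2 + y ≤ x

module _ {k} (A : Fin k → ℕ → Bool) where

  record Transversal (act : Subset k) (lo hi m : ℕ) : Set where
    field
      pos        : Fin k → Maybe ℕ
      size       : #just pos ≡ m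
      pos∈A      : ∀ {i x} → pos i ≡ just x → T (A i x)
      pos∈window : ∀ {i x} → pos i ≡ just x → lo ≤ x × x < hi
      pos-active : ∀ {i x} → pos i ≡ just x → i ∈ₛ act
      pos-apart  : ∀ {i j x y} → i ≢ j → pos i ≡ just x → pos j ≡ just y → Apart x y

  empty : ∀ {act lo hi} → Transversal act lo hi 0
  empty = record
    { pos = const nothing ; size = #just-nothing k ; pos∈A = λ () ; pos∈window = λ ()
    ; pos-active = λ () ; pos-apart = λ _ () }
    where
    #just-nothing : ∀ k → #just {k} {ℕ} (const nothing) ≡ 0
    #just-nothing zero    = refl
    #just-nothing (suc k) = #just-nothing k

  rewindow : ∀ {act lo hi lo′ hi′ m} → (∀ {x} → lo ≤ x → x < hi → lo′ ≤ x × x < hi′) →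
             Transversal act lo hi m → Transversal act lo′ hi′ m
  rewindow within R = record
    { pos = pos ; size = size ; pos∈A = pos∈A ; pos-active = pos-active ; pos-apart = pos-apart
    ; pos∈window = λ eq → within (proj₁ (pos∈window eq)) (proj₂ (pos∈window eq)) }
    where open Transversal R

  extend : ∀ {act lo hi m J y} → Transversal (act - J) lo hi m → J ∈ₛ act →
           T (A J y) → 2 + y ≤ lo → y < hi → Transversal act y hi (suc m)
  extend {act} {lo} {hi} {m} {J} {y} R J∈act J∋y y+2≤lo y<hi = record
    { pos = pos′ ; size = trans (#just-updateAt pos J J-free) (cong suc size)
    ; pos∈A = pos∈A′ ; pos∈window = pos∈window′ ; pos-active = pos-active′ ; pos-apart = pos-apart′ }
    where
    open Transversal R
    pos′ : Fin k → Maybe ℕ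
    pos′ = updateAt pos J (const (just y))
    J-free : pos J ≡ nothing
    J-free with pos J in eq
    ... | nothing = refl
    ... | just _  = contradiction (pos-active eq) (x∉p-x act J)
    beyond : ∀ {i x} → pos i ≡ just x → 2 + y ≤ x
    beyond eq = ≤-trans y+2≤lo (proj₁ (pos∈window eq))
    pos∈A′ : ∀ {i x} → pos′ i ≡ just x → T (A i x)
    pos∈A′ eq with updateAt-just pos J eq
    ... | inj₁ (refl , refl) = J∋y
    ... | inj₂ (_ , old)     = pos∈A old
    pos∈window′ : ∀ {i x} → pos′ i ≡ just x → y ≤ x × x < hi
    pos∈window′ eq with updateAt-just pos J eq
    ... | inj₁ (refl , refl) = ≤-refl , y<hi
    ... | inj₂ (_ , old)     = ≤-trans (m≤n+m y 2) (beyond old) , proj₂ (pos∈window old)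
    pos-active′ : ∀ {i x} → pos′ i ≡ just x → i ∈ₛ act
    pos-active′ eq with updateAt-just pos J eq
    ... | inj₁ (refl , refl) = J∈act
    ... | inj₂ (_ , old)     = p─q⊆p act _ (pos-active old)
    pos-apart′ : ∀ {i j x x′} → i ≢ j → pos′ i ≡ just x → pos′ j ≡ just x′ → Apart x x′
    pos-apart′ i≢j eq eq′ with updateAt-just pos J eq | updateAt-just pos J eq′
    ... | inj₁ (refl , refl) | inj₁ (refl , _)    = contradiction refl i≢j
    ... | inj₁ (refl , refl) | inj₂ (_ , old′)    = inj₁ (beyond old′)
    ... | inj₂ (_ , old)     | inj₁ (refl , refl) = inj₂ (beyond old)
    ... | inj₂ (_ , old)     | inj₂ (_ , old′)    = pos-apart i≢j old old′

  module _ (sparse : ∀ i → Sparse (A i)) where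

    private
      enough-after-pick : ∀ {act J m a L} →
        (∀ {i} → i ∈ₛ act → suc m ≤ count (A i) a (suc L)) →
        (∀ {i} → i ∈ₛ act - J → m ≤ count (A i) (2 + a) (pred L))
      enough-after-pick {act} {J} {a = a} {L} enough i∈act-J =
        ≤-pred (≤-trans (enough (p─q⊆p act ⁅ J ⁆ i∈act-J)) (count-after-pick _ (sparse _) a L))

      size-after-pick : ∀ {act : Subset k} {J m} → J ∈ₛ act → suc m ≤ ∣ act ∣ → m ≤ ∣ act - J ∣
      size-after-pick J∈act m<∣act∣ = ≤-pred (≤-trans m<∣act∣ (≤-reflexive (∣p∣≡1+∣p-x∣ J∈act)))

      serve : ∀ {act J m a L} → J ∈ₛ act → T (A J a) →
              Transversal (act - J) (2 + a) (2 + a + pred L) m → Transversal act a (a + suc L) (suc m)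
      serve {a = a} {L} J∈act J∋a R =
        extend (rewindow (λ 2+a≤x x<end → 2+a≤x , split-window {a} {2} {suc L} 2+a≤x x<end) R)
        J∈act J∋a ≤-refl (m<m+n a z<s)

    greedy : ∀ L a m (act : Subset k) → m ≤ ∣ act ∣ →
             (∀ {i} → i ∈ₛ act → m ≤ count (A i) a L) → Transversal act a (a + L) m
    greedy L a zero act _ _ = empty
    greedy zero a (suc m) act m<∣act∣ enough with ∣p∣>0⇒Nonempty act (≤-trans (s≤s z≤n) m<∣act∣)
    ... | _ , i∈act = contradiction (enough i∈act) λ ()
    greedy (suc L) a (suc m) act m<∣act∣ enough with any? (λ i → i ∈? act ×-dec T? (A i a))
    ... | no none = rewindow (λ a<x x<end → <⇒≤ a<x , split-window {a} {1} {suc L} a<x x<end)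
      (greedy L (suc a) (suc m) act m<∣act∣ λ i∈act →
        ≤-trans (enough i∈act) (≤-reflexive (count-skip _ a L λ i∋a → none (_ , i∈act , i∋a))))
    greedy (suc zero) a (suc m) act m<∣act∣ enough | yes (J , J∈act , J∋a) =
      serve J∈act J∋a (greedy zero (2 + a) m (act - J)
        (size-after-pick J∈act m<∣act∣) (enough-after-pick {J = J} {L = zero} enough))
    greedy (suc (suc L)) a (suc m) act m<∣act∣ enough | yes (J , J∈act , J∋a) =
      serve J∈act J∋a (greedy L (2 + a) m (act - J)
        (size-after-pick J∈act m<∣act∣) (enough-after-pick {J = J} {L = suc L} enough))

-- Windows on the cycle

module _ {t′ : ℕ} where

  private
    t : ℕ
    t = suc t′

  %-injective-window : ∀ {x y} → x ≤ y → y < x + t → x % t ≡ y % t → x ≡ y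
  %-injective-window {x} {y} x≤y y<x+t x%t≡y%t = ≤-antisym x≤y (m∸n≡0⇒m≤n y∸x≡0)
    where
    open ≡-Reasoning
    y∸x≡[y/t∸x/t]*t : y ∸ x ≡ (y / t ∸ x / t) * t
    y∸x≡[y/t∸x/t]*t = begin
      y ∸ x                                        ≡⟨ cong₂ _∸_ (m≡m%n+[m/n]*n y t) (m≡m%n+[m/n]*n x t) ⟩
      (y % t + y / t * t) ∸ (x % t + x / t * t)    ≡⟨ cong (λ r → (r + y / t * t) ∸ (x % t + x / t * t)) (sym x%t≡y%t) ⟩
      (x % t + y / t * t) ∸ (x % t + x / t * t)    ≡⟨ [m+n]∸[m+o]≡n∸o (x % t) _ _ ⟩
      y / t * t ∸ x / t * t                        ≡⟨ *-distribʳ-∸ t (y / t) (x / t) ⟨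
      (y / t ∸ x / t) * t                          ∎
    y/t∸x/t<1 : y / t ∸ x / t < 1
    y/t∸x/t<1 = *-cancelʳ-< t _ 1 (subst (_< 1 * t) y∸x≡[y/t∸x/t]*t
      (subst (y ∸ x <_) (sym (*-identityˡ t)) (m<n+o⇒m∸n<o y x y<x+t)))
    y∸x≡0 : y ∸ x ≡ 0
    y∸x≡0 = trans y∸x≡[y/t∸x/t]*t (cong (_* t) (n<1⇒n≡0 y/t∸x/t<1))

  toℕ-mod : ∀ j → toℕ (j mod t) ≡ j % t
  toℕ-mod j = Finₚ.toℕ-fromℕ< (m%n<n j t)

  mod-cong : ∀ i j → i % t ≡ j % t → i mod t ≡ j mod t
  mod-cong i j eq = Finₚ.fromℕ<-cong _ _ eq (m%n<n i t) (m%n<n j t)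

  mod-toℕ : ∀ (v : Fin t) → toℕ v mod t ≡ v
  mod-toℕ v = trans (Finₚ.fromℕ<-cong _ _ (m<n⇒m%n≡m v<t) (m%n<n (toℕ v) t) v<t) (Finₚ.fromℕ<-toℕ v v<t)
    where
    v<t : toℕ v < t
    v<t = Finₚ.toℕ<n v

  mod-periodic : ∀ j → (t + j) mod t ≡ j mod t
  mod-periodic j = mod-cong (t + j) j (trans (cong (_% t) (+-comm t j)) ([m+n]%n≡m%n j t))

  shift-mod : ∀ k j → shift k (j mod t) ≡ (k + j) mod t
  shift-mod k j = mod-cong (toℕ (j mod t) + k) (k + j) (begin
    (toℕ (j mod t) + k) % t      ≡⟨ cong (λ r → (r + k) % t) (toℕ-mod j) ⟩
    (j % t + k) % t              ≡⟨ %-distribˡ-+ (j % t) k t ⟩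
    (j % t % t + k % t) % t      ≡⟨ cong (λ r → (r + k % t) % t) (m%n%n≡m%n j t) ⟩
    (j % t + k % t) % t          ≡⟨ %-distribˡ-+ j k t ⟨
    (j + k) % t                  ≡⟨ cong (_% t) (+-comm j k) ⟩
    (k + j) % t                  ∎)
    where open ≡-Reasoning

  shift-toℕ : ∀ k (v : Fin t) → shift k v ≡ (k + toℕ v) mod t
  shift-toℕ k v = trans (cong (shift k) (sym (mod-toℕ v))) (shift-mod k (toℕ v))

  mod-injective-window : ∀ {w x y} → w ≤ x → x < w + t → w ≤ y → y < w + t → x mod t ≡ y mod t → x ≡ y
  mod-injective-window {w} {x} {y} w≤x x<w+t w≤y y<w+t eq with ≤-total x y
  ... | inj₁ x≤y = %-injective-window x≤y (≤-trans y<w+t (+-monoˡ-≤ t w≤x)) x%t≡y%t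
    where
    x%t≡y%t : x % t ≡ y % t
    x%t≡y%t = trans (sym (toℕ-mod x)) (trans (cong toℕ eq) (toℕ-mod y))
  ... | inj₂ y≤x = sym (%-injective-window y≤x (≤-trans x<w+t (+-monoˡ-≤ t w≤y)) y%t≡x%t)
    where
    y%t≡x%t : y % t ≡ x % t
    y%t≡x%t = trans (sym (toℕ-mod y)) (trans (cong toℕ (sym eq)) (toℕ-mod x))

  next-mod : ∀ j → next (j mod t) ≡ suc j mod t
  next-mod = shift-mod 1

  private
    apart⇒≢ : ∀ {x y} → Apart x y → x ≢ y
    apart⇒≢ (inj₁ 2+x≤x) refl = ≤⇒≯ 2+x≤x (m<n+m _ z<s)
    apart⇒≢ (inj₂ 2+y≤y) refl = ≤⇒≯ 2+y≤y (m<n+m _ z<s)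

    apart⇒≢suc : ∀ {x y} → Apart x y → y ≢ suc x
    apart⇒≢suc (inj₁ 2+x≤1+x) refl = n≮n _ 2+x≤1+x
    apart⇒≢suc (inj₂ 3+x≤x)   refl = ≤⇒≯ 3+x≤x (m<n+m _ z<s)

    apart-sym : ∀ {x y} → Apart x y → Apart y x
    apart-sym (inj₁ 2+x≤y) = inj₂ 2+x≤y
    apart-sym (inj₂ 2+y≤x) = inj₁ 2+y≤x

  module _ {w : ℕ} where

    InWindow : ℕ → Set
    InWindow x = w ≤ x × x < w + t′

    private
      in-cycle : ∀ {x} → InWindow x → x < w + t
      in-cycle (_ , x<w+t′) = ≤-trans x<w+t′ (+-monoʳ-≤ w (n≤1+n t′))

      suc-in-cycle : ∀ {x} → InWindow x → suc x < w + t
      suc-in-cycle (_ , x<w+t′) = ≤-trans (s≤s x<w+t′) (≤-reflexive (sym (+-suc w t′)))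

      adjacent⇒suc : ∀ {x y} → InWindow x → InWindow y → y mod t ≡ next (x mod t) → y ≡ suc x
      adjacent⇒suc x∈ y∈@(w≤y , _) eq = mod-injective-window w≤y (in-cycle y∈)
        (m≤n⇒m≤1+n (proj₁ x∈)) (suc-in-cycle x∈) (trans eq (next-mod _))

    apart⇒mod-≢ : ∀ {x y} → InWindow x → InWindow y → Apart x y → x mod t ≢ y mod t
    apart⇒mod-≢ x∈@(w≤x , _) y∈@(w≤y , _) x⁓y eq =
      apart⇒≢ x⁓y (mod-injective-window w≤x (in-cycle x∈) w≤y (in-cycle y∈) eq)

    apart⇒¬adjacent : ∀ {x y} → InWindow x → InWindow y → Apart x y → ¬ Cycle t (x mod t) (y mod t)
    apart⇒¬adjacent x∈ y∈ x⁓y (inj₁ y≡next-x) = apart⇒≢suc x⁓y (adjacent⇒suc x∈ y∈ y≡next-x)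
    apart⇒¬adjacent x∈ y∈ x⁓y (inj₂ x≡next-y) = apart⇒≢suc (apart-sym x⁓y) (adjacent⇒suc y∈ x∈ x≡next-y)

  -- In C₁ the only vertex is its own neighbour.
  ¬self-adjacent : 1 ≤ t′ → ∀ v → ¬ Cycle t v v
  ¬self-adjacent 1≤t′ v adj = 1+n≢n (sym (mod-injective-window ≤-refl (m<m+n x z<s)
    (n≤1+n x) (≤-trans (s≤s (m<m+n x 1≤t′)) (≤-reflexive (sym (+-suc x t′)))) loop))
    where
    x : ℕ
    x = toℕ v
    loop : x mod t ≡ suc x mod t
    loop = trans (mod-toℕ v) (trans (reduce adj) (shift-toℕ 1 v))

-- Rainbow independent sets from transversals

does-∈? : ∀ {n} (p : Subset n) x → does (x ∈? p) ≡ lookup p x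
does-∈? (inside  ∷ p) zero    = refl
does-∈? (outside ∷ p) zero    = refl
does-∈? (_       ∷ p) (suc x) = does-∈? p x

module _ {t′ : ℕ} where

  private
    t : ℕ
    t = suc t′

  unroll : Subset t → ℕ → Bool
  unroll S j = does (j mod t ∈? S)

  unroll⇒∈ : ∀ {S} j → T (unroll S j) → j mod t ∈ₛ S
  unroll⇒∈ {S} j j∈S with j mod t ∈? S
  ... | yes j∈S′ = j∈S′

  ∈⇒unroll : ∀ {S v} j → v ≡ j mod t → v ∈ₛ S → T (unroll S j)
  ∈⇒unroll {S} j refl j∈S with j mod t ∈? S
  ... | yes _   = _
  ... | no  j∉S = j∉S j∈S

  ∉⇒¬unroll : ∀ {S v} j → v ≡ j mod t → v ∉ₛ S → ¬ T (unroll S j)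
  ∉⇒¬unroll j refl v∉S j∈S = v∉S (unroll⇒∈ j j∈S)

  unroll-periodic : ∀ S j → unroll S (t + j) ≡ unroll S j
  unroll-periodic S j = cong (λ v → does (v ∈? S)) (mod-periodic j)

  count-unroll : ∀ S a → count (unroll S) a t ≡ ∣ S ∣
  count-unroll S a = trans (count-periodic (unroll S) t (unroll-periodic S) a)
    (count-subset S (unroll S) (λ v → trans (cong (λ u → does (u ∈? S)) (mod-toℕ v)) (does-∈? S v)))

  unroll-sparse : ∀ {S} → Independent (Cycle t) S → Sparse (unroll S)
  unroll-sparse indep j j∈S suc-j∈S =
    indep _ _ (unroll⇒∈ j j∈S) (unroll⇒∈ (suc j) suc-j∈S) (inj₁ (sym (next-mod j)))

increasing⇒injective : ∀ {m k} (f : Fin m → Fin k) → (∀ a b → a <ᶠ b → f a <ᶠ f b) →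
                       ∀ {a b} → a ≢ b → f a ≢ f b
increasing⇒injective f increasing {a} {b} a≢b with Finₚ.<-cmp a b
... | tri< a<b _ _ = Finₚ.<⇒≢ (increasing a b a<b)
... | tri≈ _ a≡b _ = contradiction a≡b a≢b
... | tri> _ _ b<a = Finₚ.<⇒≢ (increasing b a b<a) ∘ sym

module _ {k t′ : ℕ} (F : Collection k (suc t′)) where

  private
    t : ℕ
    t = suc t′

  transversal⇒rainbow : 1 ≤ t′ → ∀ {act w m} → Transversal (unroll ∘ F) act w (w + t′) m →
                        RainbowIndep (Cycle t) F m
  transversal⇒rainbow 1≤t′ {w = w} R = subst (RainbowIndep (Cycle t) F) size record
    { idx = index ; idx-inc = increasing ; elt = elt ; elt-inj = elt-injective
    ; elt-mem = λ a → unroll⇒∈ (value a) (pos∈A (index-just a)) ; indep = independent }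
    where
    open Transversal R
    open Enumeration (enumerate pos)
    elt : Fin (#just pos) → Fin t
    elt a = value a mod t
    window : ∀ a → InWindow {w = w} (value a)
    window a = pos∈window (index-just a)
    apart : ∀ {a b} → a ≢ b → Apart (value a) (value b)
    apart a≢b = pos-apart (increasing⇒injective index increasing a≢b) (index-just _) (index-just _)
    elt-injective : ∀ {a b} → elt a ≡ elt b → a ≡ b
    elt-injective {a} {b} eq with a ≟ b
    ... | yes a≡b = a≡b
    ... | no  a≢b = contradiction eq (apart⇒mod-≢ (window a) (window b) (apart a≢b))
    independent : ∀ a b → ¬ Cycle t (elt a) (elt b)
    independent a b with a ≟ b
    ... | yes refl = ¬self-adjacent 1≤t′ (elt a)
    ... | no  a≢b  = apart⇒¬adjacent (window a) (window b) (apart a≢b)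

module _ {k n t′ : ℕ} (F : Collection k (suc t′)) (F-indep : IndepNSets (Cycle (suc t′)) n F) where

  private
    t : ℕ
    t = suc t′

  sparse : ∀ i → Sparse (unroll (F i))
  sparse i = unroll-sparse (proj₁ (F-indep i))

  count-period : ∀ i a → count (unroll (F i)) a t ≡ n
  count-period i a = trans (count-unroll (F i) a) (proj₂ (F-indep i))

  rainbow-<n : 1 ≤ t′ → ∀ {r} → r ≤ k → r < n → RainbowIndep (Cycle t) F r
  rainbow-<n 1≤t′ {r} r≤k r<n =
    transversal⇒rainbow F 1≤t′ (greedy (unroll ∘ F) sparse t′ 1 r ⊤ r≤∣⊤∣ enough)
    where
    r≤∣⊤∣ : r ≤ ∣ ⊤ {k} ∣
    r≤∣⊤∣ = subst (r ≤_) (sym (∣⊤∣≡n k)) r≤k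
    enough : ∀ {i} → i ∈ₛ ⊤ → r ≤ count (unroll (F i)) 1 t′
    enough {i} _ = ≤-pred (begin
      suc r                                ≤⟨ r<n ⟩
      n                                    ≡⟨ count-period i 0 ⟨
      count (unroll (F i)) 0 t             ≤⟨ count-drop-first _ 0 t′ ⟩
      suc (count (unroll (F i)) 1 t′)      ∎)
      where open ≤-Reasoning

distinct⇒1≤n : ∀ {n} (I J : Fin (suc n)) → I ≢ J → 1 ≤ n
distinct⇒1≤n {zero}  zero zero I≢J = contradiction refl I≢J
distinct⇒1≤n {suc n} _    _    _   = s≤s z≤n

module _ {k t : ℕ} (F : Collection k t) where

  ∈⇒∈C : ∀ {v I} → v ∈ₛ F I → I ∈ C F v
  ∈⇒∈C {v} {I} v∈FI = ∈-filter⁺ (λ i → v ∈? F i) (∈-allFin I) v∈FI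

  ∈C⇒∈ : ∀ {v I} → I ∈ C F v → v ∈ₛ F I
  ∈C⇒∈ {v} I∈Cv = proj₂ (∈-filter⁻ (λ i → v ∈? F i) {xs = allFin _} I∈Cv)

  lone⇒∈ : ∀ {v I} → C F v ≡ [ I ] → v ∈ₛ F I
  lone⇒∈ lone = ∈C⇒∈ (subst (_ ∈_) (sym lone) (here refl))

  lone⇒∉ : ∀ {v I K} → C F v ≡ [ I ] → K ≢ I → v ∉ₛ F K
  lone⇒∉ lone K≢I v∈FK with subst (_ ∈_) lone (∈⇒∈C v∈FK)
  ... | here K≡I = K≢I K≡I

  holder : ∀ v → 0 < length (C F v) → ∃ λ J → v ∈ₛ F J
  holder v 0<c with C F v in eq
  ... | J ∷ _ = J , ∈C⇒∈ (subst (J ∈_) (sym eq) (here refl))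

  uncovered : ∀ {v I} → c F v ≡ 0 → v ∉ₛ F I
  uncovered c≡0 v∈FI = <⇒≢ (∈-length (∈⇒∈C v∈FI)) (sym c≡0)

-- The cycle length is written 2 + s so that prev i and prev2 i compute to shift (1 + s) i and shift s i.
module Extremal {n′ s : ℕ} (F : Collection (suc n′) (2 + s))
                (F-indep : IndepNSets (Cycle (2 + s)) (suc n′) F)
                {m : ℕ} (m-max : IsMaxRainbow (Cycle (2 + s)) F m) (m≡n′ : m ≡ n′) where

  private
    n t : ℕ
    n = suc n′
    t = 2 + s
    P : Fin n → ℕ → Bool
    P K = unroll (F K)
    sparse-P : ∀ K → Sparse (P K)
    sparse-P = sparse F F-indep

  no-transversal-of-size-n : ∀ {act w} → ¬ Transversal P act w (w + suc s) n
  no-transversal-of-size-n R =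
    1+n≰n (subst (n ≤_) m≡n′ (proj₂ m-max n (transversal⇒rainbow F (s≤s z≤n) R)))

  covered : ∀ v → 0 < c F v
  covered v with c F v in c≡
  ... | suc _ = z<s
  ... | zero  = ⊥-elim (no-transversal-of-size-n
    (greedy P sparse-P (suc s) (suc a) n ⊤ (≤-reflexive (sym (∣⊤∣≡n n))) enough))
    where
    a : ℕ
    a = toℕ v
    enough : ∀ {K} → K ∈ₛ ⊤ → n ≤ count (P K) (suc a) (suc s)
    enough {K} _ = ≤-reflexive (trans (sym (count-period F F-indep K a))
      (count-skip (P K) a (suc s) (∉⇒¬unroll a (sym (mod-toℕ v)) (uncovered F c≡))))

  single-pick-impossible : ∀ q J → T (P J (suc q)) → (∀ {K} → K ≢ J → count (P K) q 3 ≤ 1) → ⊥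
  single-pick-impossible q J J∋1+q others = no-transversal-of-size-n
    (extend P (rewindow P within R) ∈⊤ J∋1+q ≤-refl (m<m+n (suc q) z<s))
    where
    size : n′ ≤ ∣ ⊤ - J ∣
    size = ≤-reflexive (suc-injective (trans (sym (∣⊤∣≡n n)) (∣p∣≡1+∣p-x∣ (∈⊤ {x = J}))))
    enough : ∀ {K} → K ∈ₛ ⊤ - J → n′ ≤ count (P K) (3 + q) (t ∸ 3)
    enough {K} K∈⊤-J = ≤-pred (begin
      n                                               ≡⟨ count-period F F-indep K q ⟨
      count (P K) q t                                 ≤⟨ count-split (P K) q 3 t ⟩
      count (P K) q 3 + count (P K) (3 + q) (t ∸ 3)   ≤⟨ +-monoˡ-≤ _ (others K≢J) ⟩
      suc (count (P K) (3 + q) (t ∸ 3))               ∎)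
      where
      open ≤-Reasoning
      K≢J : K ≢ J
      K≢J refl = x∉p-x ⊤ J K∈⊤-J
    R : Transversal P (⊤ - J) (3 + q) (3 + q + (t ∸ 3)) n′
    R = greedy P sparse-P (t ∸ 3) (3 + q) n′ (⊤ - J) size enough
    within : ∀ {x} → 3 + q ≤ x → x < 3 + q + (t ∸ 3) → 3 + q ≤ x × x < suc q + suc s
    within {x} 3+q≤x x<end = 3+q≤x , subst (x <_) (+-suc q (suc s)) (split-window {q} {3} {t} 3+q≤x x<end)

  double-pick-impossible : 5 ≤ t → ∀ q I J → I ≢ J → T (P J (suc q)) → T (P I (4 + q)) →
                           (∀ {K} → K ≢ I → K ≢ J → count (P K) q 6 ≤ 2) → ⊥
  double-pick-impossible 5≤t q I J I≢J J∋1+q I∋4+q others = no-transversal-of-size-n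
    (subst (Transversal P ⊤ (suc q) (suc q + suc s)) (cong suc (m+[n∸m]≡n 1≤n′))
      (extend P (extend P (rewindow P within R) I∈⊤-J I∋4+q ≤-refl 4+q<end)
        ∈⊤ J∋1+q (n≤1+n _) (m<m+n (suc q) z<s)))
    where
    1≤n′ : 1 ≤ n′
    1≤n′ = distinct⇒1≤n I J I≢J
    I∈⊤-J : I ∈ₛ ⊤ - J
    I∈⊤-J = x∈p∧x≢y⇒x∈p-y ∈⊤ I≢J
    size : n′ ∸ 1 ≤ ∣ ⊤ - J - I ∣
    size = ≤-reflexive (cong (_∸ 1) (suc-injective (begin
      n                        ≡⟨ ∣⊤∣≡n n ⟨
      ∣ ⊤ {n} ∣                ≡⟨ ∣p∣≡1+∣p-x∣ (∈⊤ {x = J}) ⟩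
      suc ∣ ⊤ - J ∣            ≡⟨ cong suc (∣p∣≡1+∣p-x∣ I∈⊤-J) ⟩
      suc (suc ∣ ⊤ - J - I ∣)  ∎)))
      where open ≡-Reasoning
    enough : ∀ {K} → K ∈ₛ ⊤ - J - I → n′ ∸ 1 ≤ count (P K) (6 + q) (t ∸ 6)
    enough {K} K∈⊤-J-I = +-cancelˡ-≤ 2 _ _ (begin
      2 + (n′ ∸ 1)                                    ≡⟨ cong suc (m+[n∸m]≡n 1≤n′) ⟩
      n                                               ≡⟨ count-period F F-indep K q ⟨
      count (P K) q t                                 ≤⟨ count-split (P K) q 6 t ⟩
      count (P K) q 6 + count (P K) (6 + q) (t ∸ 6)   ≤⟨ +-monoˡ-≤ _ (others K≢I K≢J) ⟩
      2 + count (P K) (6 + q) (t ∸ 6)                 ∎)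
      where
      open ≤-Reasoning
      K≢I : K ≢ I
      K≢I refl = x∉p-x (⊤ - J) I K∈⊤-J-I
      K≢J : K ≢ J
      K≢J refl = x∉p-x ⊤ J (p─q⊆p (⊤ - J) ⁅ I ⁆ K∈⊤-J-I)
    R : Transversal P (⊤ - J - I) (6 + q) (6 + q + (t ∸ 6)) (n′ ∸ 1)
    R = greedy P sparse-P (t ∸ 6) (6 + q) (n′ ∸ 1) (⊤ - J - I) size enough
    within : ∀ {x} → 6 + q ≤ x → x < 6 + q + (t ∸ 6) → 6 + q ≤ x × x < suc q + suc s
    within {x} 6+q≤x x<end = 6+q≤x , subst (x <_) (+-suc q (suc s)) (split-window {q} {6} {t} 6+q≤x x<end)
    4+q<end : 4 + q < suc q + suc s
    4+q<end = s≤s (≤-trans (+-monoˡ-≤ q (≤-pred 5≤t)) (≤-reflexive (+-comm (suc s) q)))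

  -- Position s + toℕ i thus stands for the vertex i − 2.
  lap : ∀ j a → (2 + j + (s + a)) mod t ≡ (j + a) mod t
  lap j a = trans (cong (λ x → (2 + x) mod t) j+[s+a]≡s+[j+a]) (mod-periodic (j + a))
    where
    j+[s+a]≡s+[j+a] : j + (s + a) ≡ s + (j + a)
    j+[s+a]≡s+[j+a] = trans (sym (+-assoc j s a)) (trans (cong (_+ a) (+-comm j s)) (+-assoc s j a))

  lone⇒next2 : ∀ i I → C F i ≡ [ I ] → next2 i ∈ₛ F I
  lone⇒next2 i I lone with next2 i ∈? F I
  ... | yes next2∈FI = next2∈FI
  ... | no  next2∉FI with holder F (next i) (covered (next i))
  ...   | J , next∈FJ = ⊥-elim (single-pick-impossible a J (∈⇒unroll (suc a) (shift-toℕ 1 i) next∈FJ) others)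
    where
    a : ℕ
    a = toℕ i
    others : ∀ {K} → K ≢ J → count (P K) a 3 ≤ 1
    others {K} _ with K ≟ I
    ... | yes refl = count-three-absent-last (P K) (sparse-P K) a
                       (∉⇒¬unroll (2 + a) (shift-toℕ 2 i) next2∉FI)
    ... | no  K≢I  = count-three-absent-first (P K) (sparse-P K) a
                       (∉⇒¬unroll a (sym (mod-toℕ i)) (lone⇒∉ F lone K≢I))

  lone⇒prev2 : ∀ i I → C F i ≡ [ I ] → prev2 i ∈ₛ F I
  lone⇒prev2 i I lone with prev2 i ∈? F I
  ... | yes prev2∈FI = prev2∈FI
  ... | no  prev2∉FI with holder F (prev i) (covered (prev i))
  ...   | J , prev∈FJ = ⊥-elim (single-pick-impossible q J (∈⇒unroll (suc q) (shift-toℕ (suc s) i) prev∈FJ) others)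
    where
    a q : ℕ
    a = toℕ i
    q = s + a
    others : ∀ {K} → K ≢ J → count (P K) q 3 ≤ 1
    others {K} _ with K ≟ I
    ... | yes refl = count-three-absent-first (P K) (sparse-P K) q
                       (∉⇒¬unroll q (shift-toℕ s i) prev2∉FI)
    ... | no  K≢I  = count-three-absent-last (P K) (sparse-P K) q
                       (∉⇒¬unroll (2 + q) (sym (trans (lap 0 a) (mod-toℕ i))) (lone⇒∉ F lone K≢I))

  consecutive-lones-impossible : suc (2 * n) ≤ t → ∀ u I J → C F u ≡ [ I ] → C F (next u) ≡ [ J ] → ⊥
  consecutive-lones-impossible 2n<t u I J lone-u lone-next =
    double-pick-impossible 5≤t q I J I≢J J∋1+q I∋4+q others
    where
    a q : ℕ
    a = toℕ u
    q = s + a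
    I≢J : I ≢ J
    I≢J refl = proj₁ (F-indep I) u (next u) (lone⇒∈ F lone-u) (lone⇒∈ F lone-next) (inj₁ refl)
    5≤t : 5 ≤ t
    5≤t = ≤-trans (s≤s (*-monoʳ-≤ 2 (s≤s (distinct⇒1≤n I J I≢J)))) 2n<t
    J∋1+q : T (P J (suc q))
    J∋1+q = ∈⇒unroll (suc q) prev2-next≡ (lone⇒prev2 (next u) J lone-next)
      where
      prev2-next≡ : prev2 (next u) ≡ suc q mod t
      prev2-next≡ = trans (cong (shift s) (shift-toℕ 1 u)) (trans (shift-mod s (suc a)) (cong (_mod t) (+-suc s a)))
    I∋4+q : T (P I (4 + q))
    I∋4+q = ∈⇒unroll (4 + q) (trans (shift-toℕ 2 u) (sym (lap 2 a))) (lone⇒next2 u I lone-u)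
    others : ∀ {K} → K ≢ I → K ≢ J → count (P K) q 6 ≤ 2
    others K≢I K≢J = count-six-absent-middle (P _) (sparse-P _) q
      (∉⇒¬unroll (2 + q) (sym (trans (lap 0 a) (mod-toℕ u))) (lone⇒∉ F lone-u K≢I))
      (∉⇒¬unroll (3 + q) (trans (shift-toℕ 1 u) (sym (lap 1 a))) (lone⇒∉ F lone-next K≢J))

  more-than-one : ∀ v → (∀ J → C F v ≢ [ J ]) → 1 < c F v
  more-than-one v not-lone with C F v | covered v
  ... | J ∷ []    | _ = ⊥-elim (not-lone J refl)
  ... | _ ∷ _ ∷ _ | _ = s≤s z<s

  next-prev : ∀ i → next (prev i) ≡ i
  next-prev i = begin
    next (prev i)                      ≡⟨ cong next (shift-toℕ (suc s) i) ⟩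
    next ((suc s + toℕ i) mod t)       ≡⟨ next-mod (suc s + toℕ i) ⟩
    (t + toℕ i) mod t                  ≡⟨ mod-periodic (toℕ i) ⟩
    toℕ i mod t                        ≡⟨ mod-toℕ i ⟩
    i                                  ∎
    where open ≡-Reasoning

  lone-neighbours : suc (2 * n) ≤ t → ∀ i → c F i ≡ 1 → 1 < c F (next i) × 1 < c F (prev i)
  lone-neighbours 2n<t i ci≡1 with C F i in lone
  ... | I ∷ [] =
      more-than-one (next i) (λ J lone-next → consecutive-lones-impossible 2n<t i I J lone lone-next)
    , more-than-one (prev i) (λ J lone-prev → consecutive-lones-impossible 2n<t (prev i) J I lone-prev
                                                 (subst (λ v → C F v ≡ [ I ]) (sym (next-prev i)) lone))

-- Minimality of n − 1

increasing⇒≤ : ∀ {m k} (f : Fin m → Fin k) → (∀ a b → a <ᶠ b → f a <ᶠ f b) → m ≤ k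
increasing⇒≤ {m} {k} f increasing with m ≤? k
... | yes m≤k = m≤k
... | no  m≰k with Finₚ.pigeonhole (≰⇒> m≰k) f
...   | a , b , a<b , fa≡fb = contradiction fa≡fb (Finₚ.<⇒≢ (increasing a b a<b))

first-evens : ℕ → ℕ → Bool
first-evens zero    _             = false
first-evens (suc n) zero          = true
first-evens (suc n) (suc zero)    = false
first-evens (suc n) (suc (suc j)) = first-evens n j

first-evens-sparse : ∀ n → Sparse (first-evens n)
first-evens-sparse (suc n) zero          _ ()
first-evens-sparse (suc n) (suc (suc j)) j∈ = first-evens-sparse n j j∈

first-evens-< : ∀ n j → T (first-evens n j) → 2 + j ≤ 2 * n
first-evens-< (suc n) zero          _  = *-monoʳ-≤ 2 (s≤s z≤n)
first-evens-< (suc n) (suc (suc j)) j∈ =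
  ≤-trans (s≤s (s≤s (first-evens-< n j j∈))) (≤-reflexive (sym (*-suc 2 n)))

count-first-evens : ∀ n r → count (first-evens n) 0 (2 * n + r) ≡ n
count-first-evens zero    r = count-false 0 r
count-first-evens (suc n) r = begin
  count e 0 (2 * suc n + r)                 ≡⟨ cong (λ L → count e 0 (L + r)) (*-suc 2 n) ⟩
  suc (count e 2 (2 * n + r))               ≡⟨ cong suc (count-suc e 1 (2 * n + r)) ⟩
  suc (count (e ∘ suc) 1 (2 * n + r))       ≡⟨ cong suc (count-suc (e ∘ suc) 0 (2 * n + r)) ⟩
  suc (count (first-evens n) 0 (2 * n + r)) ≡⟨ cong suc (count-first-evens n r) ⟩
  suc n                                     ∎
  where
  open ≡-Reasoning
  e : ℕ → Bool
  e = first-evens (suc n)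

evens : ∀ {t} → ℕ → Subset t
evens n = tabulate (first-evens n ∘ toℕ)

∈evens⇒ : ∀ {t n} {v : Fin t} → v ∈ₛ evens n → T (first-evens n (toℕ v))
∈evens⇒ {n = n} {v} v∈ = subst T v-inside _
  where
  v-inside : true ≡ first-evens n (toℕ v)
  v-inside = trans (sym ([]=⇒lookup v∈)) (lookup∘tabulate (first-evens n ∘ toℕ) v)

∣evens∣ : ∀ {t n} → 2 * n ≤ t → ∣ evens {t} n ∣ ≡ n
∣evens∣ {t} {n} 2n≤t = begin
  ∣ evens {t} n ∣                        ≡⟨ count-subset (evens {t} n) (first-evens n) agree ⟨
  count (first-evens n) 0 t              ≡⟨ cong (count (first-evens n) 0) (m+[n∸m]≡n 2n≤t) ⟨
  count (first-evens n) 0 (2 * n + (t ∸ 2 * n)) ≡⟨ count-first-evens n (t ∸ 2 * n) ⟩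
  n                                      ∎
  where
  open ≡-Reasoning
  agree : ∀ i → first-evens n (toℕ i) ≡ lookup (evens {t} n) i
  agree i = sym (lookup∘tabulate (first-evens n ∘ toℕ) i)

evens-not-consecutive : ∀ {t′ n} {x : Fin (suc t′)} → 2 * n ≤ suc t′ →
                        x ∈ₛ evens n → ¬ next x ∈ₛ evens n
evens-not-consecutive {t′} {n} {x} 2n≤t x∈ next∈ with suc (toℕ x) <? suc t′
... | yes 1+x<t =
  first-evens-sparse n (toℕ x) (∈evens⇒ {n = n} x∈) (subst (T ∘ first-evens n) toℕ-next (∈evens⇒ {n = n} next∈))
  where
  toℕ-next : toℕ (next x) ≡ suc (toℕ x)
  toℕ-next = trans (cong toℕ (shift-toℕ 1 x)) (trans (toℕ-mod (suc (toℕ x))) (m<n⇒m%n≡m 1+x<t))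
... | no  1+x≮t = <⇒≱ (first-evens-< n (toℕ x) (∈evens⇒ {n = n} x∈)) (≤-trans 2n≤t (≮⇒≥ 1+x≮t))

evens-independent : ∀ {t′ n} → 2 * n ≤ suc t′ → Independent (Cycle (suc t′)) (evens n)
evens-independent {n = n} 2n≤t u v u∈ v∈ (inj₁ v≡next-u) =
  evens-not-consecutive {n = n} 2n≤t u∈ (subst (_∈ₛ evens n) v≡next-u v∈)
evens-independent {n = n} 2n≤t u v u∈ v∈ (inj₂ u≡next-v) =
  evens-not-consecutive {n = n} 2n≤t v∈ (subst (_∈ₛ evens n) u≡next-v u∈)

corollary2p4 : (n t : ℕ) → 1 ≤ n → 2 * n ≤ t →
    IsF (Cycle t) n (n ∸ 1) (n ∸ 1)
    × ((F : Collection n t) → IndepNSets (Cycle t) n F →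
       (m : ℕ) → IsMaxRainbow (Cycle t) F m →
       (n ∸ 1 ≤ m)
       × (m ≡ n ∸ 1 →
          (∀ (i : Fin t) → 0 < c F i)
          × (∀ (i : Fin t) (I : Fin n) → C F i ≡ [ I ] →
               (I ∈ C F (next2 i)) × (I ∈ C F (prev2 i)))
          × (suc (2 * n) ≤ t → ∀ (i : Fin t) → c F i ≡ 1 →
               (1 < c F (next i)) × (1 < c F (prev i)))))
corollary2p4 zero     _ () _
corollary2p4 (suc n′) t _  2n≤t with ≤-trans (*-monoʳ-≤ 2 (s≤s z≤n)) 2n≤t
... | s≤s (s≤s {n = s} _) = (rainbow-property , rainbow-property-fails) , λ F F-indep m m-max →
      proj₂ m-max n′ (rainbow-<n F F-indep (s≤s z≤n) (n≤1+n n′) ≤-refl)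
    , λ m≡n′ → let open Extremal F F-indep m-max m≡n′ in
        covered
      , (λ i I lone → ∈⇒∈C F (lone⇒next2 i I lone) , ∈⇒∈C F (lone⇒prev2 i I lone))
      , lone-neighbours
  where
  rainbow-property : RainbowProperty (Cycle (2 + s)) (suc n′) n′ n′
  rainbow-property F F-indep = rainbow-<n F F-indep (s≤s z≤n) ≤-refl ≤-refl
  rainbow-property-fails : ∀ k′ → k′ < n′ → ¬ RainbowProperty (Cycle (2 + s)) (suc n′) n′ k′
  rainbow-property-fails k′ k′<n′ property = <⇒≱ k′<n′ (increasing⇒≤ idx idx-inc)
    where
    open RainbowIndep (property (λ _ → evens (suc n′)) (λ _ → evens-independent {n = suc n′} 2n≤t , ∣evens∣ 2n≤t))
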